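{- Let $q$ be a prime power and $k\ge 3$ an integer. The setwise stabiliser of $B(k,q)$ in $\mathrm{PGL}(k-1,q^{k(k-1)})$ acts transitively on the set of points of $B(k,q)$ of any fixed weight.
   Context: Let $R=\{xy : x\in\mathbb F_{q^{k-1}},\ y\in \mathbb F_{q^k}\}\subseteq \mathbb F_{q^{k(k-1)}}$. $B(k,q)$ denotes the set of points of $\mathrm{PG}(k-2,q^{k(k-1)})$ (the projective space of the standard vector space $\mathbb F_{q^{k(k-1)}}^{k-1}$) having a coordinate vector in $R^{k-1}$. The weight of a point is the number of nonzero entries of any of its coordinate vectors with respect to the standard basis. -}

module Defs where

open import Level using (Level; _⊔_; suc)
open import Algebra.Bundles using (CommutativeRing)
open import Data.Nat as ℕ using (ℕ; zero; suc; _≥_; _∸_)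
open import Data.Nat.Primality using (Prime)
open import Data.Fin using (Fin)
import Data.Fin
open import Data.Product using (Σ; ∃; ∃-syntax; _×_; _,_)
open import Data.List using (List; foldr; length; filter)
open import Data.List.Base using (allFin)
open import Relation.Nullary using (¬_; Dec; yes; no; ¬?)
open import Relation.Binary.Definitions using (Decidable)
open import Relation.Binary.PropositionalEquality using (_≡_)

IsPrimePower : ℕ → Set
IsPrimePower q = ∃[ p ] ∃[ n ] (Prime p × n ≥ 1 × q ≡ p ℕ.^ n)

-- A finite field with exactly N elements (stdlib has no Field bundle):
-- a commutative ring with 1 ≉ 0 in which every nonzero element is
-- invertible, with decidable equality, and a bijection (w.r.t. ≈) Fin N ≅ carrier.
record FiniteField (c ℓ : Level) (N : ℕ) : Set (Level.suc (c ⊔ ℓ)) where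
  field
    ring : CommutativeRing c ℓ
  open CommutativeRing ring public hiding (ring)
  field
    1≉0      : ¬ (1# ≈ 0#)
    inverse  : ∀ x → ¬ (x ≈ 0#) → ∃[ y ] (x * y ≈ 1#)
    _≟_      : Decidable _≈_
    enum     : Fin N → Carrier
    enum-inj : ∀ i j → enum i ≈ enum j → i ≡ j
    enum-sur : ∀ x → ∃[ i ] (enum i ≈ x)

module FF {c ℓ : Level} {N : ℕ} (F : FiniteField c ℓ N) where
  open FiniteField F

  pow : Carrier → ℕ → Carrier
  pow x zero    = 1#
  pow x (suc n) = x * pow x n

  InSubfield : ℕ → ℕ → Carrier → Set ℓ
  InSubfield q e x = pow x (q ℕ.^ e) ≈ x

  InR : ℕ → ℕ → Carrier → Set (c ⊔ ℓ)
  InR q k z = ∃[ x ] ∃[ y ] (InSubfield q (k ∸ 1) x × InSubfield q k y × z ≈ x * y)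

  Vec : ℕ → Set c
  Vec m = Fin m → Carrier

  NonZero : ∀ {m} → Vec m → Set ℓ
  NonZero {m} v = ¬ (∀ i → v i ≈ 0#)

  -- u and v span the same 1-dim subspace (same projective point)
  _∼_ : ∀ {m} → Vec m → Vec m → Set (c ⊔ ℓ)
  u ∼ v = ∃[ λ′ ] (¬ (λ′ ≈ 0#) × (∀ i → u i ≈ λ′ * v i))

  -- v is a coordinate vector of a point of B(k,q) ⊆ PG(k-2, F), F = F_{q^{k(k-1)}}
  InB : (q k : ℕ) → Vec (k ∸ 1) → Set (c ⊔ ℓ)
  InB q k v = NonZero v × ∃[ w ] (w ∼ v × (∀ i → InR q k (w i)))

  weight : ∀ {m} → Vec m → ℕ
  weight {m} v = length (filter (λ i → ¬? (v i ≟ 0#)) (allFin m))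

  Matrix : ℕ → Set c
  Matrix m = Fin m → Fin m → Carrier

  sumFin : ∀ {m} → (Fin m → Carrier) → Carrier
  sumFin {m} f = foldr (λ i acc → f i + acc) 0# (allFin m)

  apply : ∀ {m} → Matrix m → Vec m → Vec m
  apply M v i = sumFin (λ j → M i j * v j)

  mul : ∀ {m} → Matrix m → Matrix m → Matrix m
  mul M N i j = sumFin (λ l → M i l * N l j)

  identity : ∀ {m} → Matrix m
  identity i j with i Data.Fin.≟ j
  ... | yes _ = 1#
  ... | no _ = 0#

  Invertible : ∀ {m} → Matrix m → Set (c ⊔ ℓ)
  Invertible {m} M = ∃[ N ] ((∀ i j → mul M N i j ≈ identity i j) ×
                             (∀ i j → mul N M i j ≈ identity i j))

  -- M (representing an element of PGL(k-1, F)) stabilises B(k,q) setwise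
  StabilisesB : (q k : ℕ) → Matrix (k ∸ 1) → Set (c ⊔ ℓ)
  StabilisesB q k M =
    (∀ v → InB q k v → InB q k (apply M v)) ×
    (∀ v → InB q k v → ∃[ u ] (InB q k u × apply M u ∼ v))

{-# OPTIONS --safe #-}
-- The monomial matrices diag(d)·P_σ whose diagonal entries d i lie in R ∖ {0} stabilise
-- B(k,q): R ∖ {0} is a multiplicative group, because the subfields F_{q^(k-1)} and F_{q^k}
-- are closed under products and inverses.  If u and v are points of B of equal weight,
-- with coordinate vectors w, w′ ∈ R^(k-1), a permutation σ carries the support of w onto
-- that of w′, and the ratios d i = w′ i / w (σ i) (taken to be 1 off the support) lie in
-- R ∖ {0}; the resulting monomial matrix sends w to w′, hence u to v.
module Submission where

open import Defs
open import Level using (Level; _⊔_)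
import Algebra.Properties.CommutativeMonoid.Sum as CommutativeMonoidSum
import Algebra.Properties.CommutativeSemigroup as CommutativeSemigroupProperties
import Algebra.Properties.CommutativeSemiring.Exp as CommutativeSemiringExp
open import Data.Bool.Base using (Bool; true; false; if_then_else_)
open import Data.Bool.Properties using (not-injective)
open import Data.Fin.Base using (Fin; zero; suc; punchIn)
import Data.Fin as Fin
open import Data.Fin.Patterns using (0F)
open import Data.Fin.Permutation as Perm using (Permutation′; _⟨$⟩ʳ_; _⟨$⟩ˡ_; _∘ₚ_)
open import Data.Fin.Properties using (punchInᵢ≢i)
open import Data.List.Base using (tabulate; filter; length; foldr; allFin)
open import Data.List.Properties using (filter-≐)
open import Data.Nat.Base as ℕ using (ℕ; zero; suc; _≥_; _∸_)
open import Data.Nat.Properties using (+-cancelˡ-≡; +-0-commutativeMonoid)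
open import Data.Vec.Functional using (replicate)
open import Data.Product.Base using (Σ-syntax; ∃-syntax; _×_; _,_; proj₁; proj₂)
open import Function.Base using (_∘_; id)
open import Function.Bundles using (_⇔_; mk⇔; Equivalence)
open import Relation.Binary.PropositionalEquality as ≡ using (_≡_; _≢_)
open import Relation.Nullary using (Dec; yes; no; does; ¬?; contradiction)
open import Relation.Unary using (Pred; Decidable)

does≡⇒⇔ : ∀ {a b} {A : Set a} {B : Set b} (a? : Dec A) (b? : Dec B) → does a? ≡ does b? → A ⇔ B
does≡⇒⇔ (yes a) (yes b) _ = mk⇔ (λ _ → b) (λ _ → a)
does≡⇒⇔ (no ¬a) (no ¬b) _ = mk⇔ (λ a → contradiction a ¬a) (λ b → contradiction b ¬b)

module ℕΣ = CommutativeMonoidSum +-0-commutativeMonoid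

count : ∀ {n} → (Fin n → Bool) → ℕ
count a = ℕΣ.sum (λ i → if a i then 1 else 0)

count-head : ∀ {n} (a : Fin (suc n) → Bool) {x} → a 0F ≡ x →
             count a ≡ (if x then 1 else 0) ℕ.+ count (a ∘ suc)
count-head a a₀≡x = ≡.cong (λ x → (if x then 1 else 0) ℕ.+ count (a ∘ suc)) a₀≡x

count-permute : ∀ {n} (a : Fin n → Bool) (σ : Permutation′ n) → count a ≡ count (a ∘ (σ ⟨$⟩ʳ_))
count-permute a σ = ℕΣ.sum-permute _ σ

count≡suc⇒∃true : ∀ {n m} (a : Fin n → Bool) → count a ≡ suc m → ∃[ j ] (a j ≡ true)
count≡suc⇒∃true {zero} a ()
count≡suc⇒∃true {suc n} a c with a 0F in a₀
... | true  = 0F , a₀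
... | false with j , aj ← count≡suc⇒∃true (a ∘ suc) c = suc j , aj

length-filter-tabulate : ∀ {a p} {A : Set a} {P : Pred A p} (P? : Decidable P) {n} (h : Fin n → A) →
                         length (filter P? (tabulate h)) ≡ count (λ i → does (P? (h i)))
length-filter-tabulate P? {zero}  h = ≡.refl
length-filter-tabulate P? {suc n} h with does (P? (h 0F))
... | true  = ≡.cong suc (length-filter-tabulate P? (h ∘ suc))
... | false = length-filter-tabulate P? (h ∘ suc)

Rearrangeable : ∀ {a} {A : Set a} {n} → (Fin n → A) → (Fin n → A) → Set a
Rearrangeable x y = ∃[ σ ] (∀ i → x (σ ⟨$⟩ʳ i) ≡ y i)

rearrangeable-sym : ∀ {a} {A : Set a} {n} {x y : Fin n → A} → Rearrangeable x y → Rearrangeable y x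
rearrangeable-sym {x = x} (σ , x∘σ≗y) =
  Perm.flip σ , λ i → ≡.trans (≡.sym (x∘σ≗y (σ ⟨$⟩ˡ i))) (≡.cong x (Perm.inverseʳ σ))

count≡⇒rearrangeable : ∀ {n} (a b : Fin n → Bool) → count a ≡ count b → Rearrangeable a b
count≡⇒rearrangeable {zero}  a b _ = Perm.id , λ ()
count≡⇒rearrangeable {suc n} a b a≡b = by-heads (a 0F) (b 0F) ≡.refl ≡.refl
  where
  equal-heads : (a b : Fin (suc n) → Bool) → count a ≡ count b → a 0F ≡ b 0F → Rearrangeable a b
  equal-heads a b a≡b a₀≡b₀
    with σ , tails ← count≡⇒rearrangeable (a ∘ suc) (b ∘ suc)
                       (+-cancelˡ-≡ _ _ _ (≡.trans a≡b (count-head b (≡.sym a₀≡b₀))))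
    = Perm.lift₀ σ , λ { 0F → a₀≡b₀ ; (suc i) → tails i }

  swap₀ : Fin n → Permutation′ (suc n)
  swap₀ j = Perm.transpose 0F (suc j)

  -- swapping position 0 with a later `true` of a reduces to the case of equal heads
  head-false-true : (a b : Fin (suc n) → Bool) → count a ≡ count b → a 0F ≡ false → b 0F ≡ true →
                    Rearrangeable a b
  head-false-true a b a≡b a₀ b₀
    with j , a[1+j] ← count≡suc⇒∃true (a ∘ suc)
                         (≡.trans (≡.sym (count-head a a₀)) (≡.trans a≡b (count-head b b₀)))
    with σ , a∘τ∘σ≗b ← equal-heads (a ∘ (swap₀ j ⟨$⟩ʳ_)) b
                         (≡.trans (≡.sym (count-permute a (swap₀ j))) a≡b) (≡.trans a[1+j] (≡.sym b₀))
    = σ ∘ₚ swap₀ j , a∘τ∘σ≗b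

  by-heads : ∀ x y → a 0F ≡ x → b 0F ≡ y → Rearrangeable a b
  by-heads true  true  a₀ b₀ = equal-heads a b a≡b (≡.trans a₀ (≡.sym b₀))
  by-heads false false a₀ b₀ = equal-heads a b a≡b (≡.trans a₀ (≡.sym b₀))
  by-heads false true  a₀ b₀ = head-false-true a b a≡b a₀ b₀
  by-heads true  false a₀ b₀ = rearrangeable-sym (head-false-true b a (≡.sym a≡b) b₀ a₀)

module MonomialAction {c ℓ N} (F : FiniteField c ℓ N) where
  open FiniteField F hiding (zero)
  open FF F
  open CommutativeSemigroupProperties *-commutativeSemigroup using (x∙yz≈y∙xz; interchange)
  open CommutativeSemiringExp commutativeSemiring using (_^_; ^-congˡ; ^-distrib-*)
  open import Relation.Binary.Reasoning.Setoid setoid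
  module +Σ = CommutativeMonoidSum +-commutativeMonoid

  inv : (x : Carrier) → x ≉ 0# → Carrier
  inv x x≉0 = proj₁ (inverse x x≉0)

  x*x⁻¹≈1 : ∀ {x} (x≉0 : x ≉ 0#) → x * inv x x≉0 ≈ 1#
  x*x⁻¹≈1 {x} x≉0 = proj₂ (inverse x x≉0)

  x⁻¹*[x*y]≈y : ∀ {x} (x≉0 : x ≉ 0#) y → inv x x≉0 * (x * y) ≈ y
  x⁻¹*[x*y]≈y {x} x≉0 y = begin
    inv x x≉0 * (x * y) ≈⟨ *-assoc _ _ _ ⟨
    inv x x≉0 * x * y   ≈⟨ *-congʳ (trans (*-comm _ _) (x*x⁻¹≈1 x≉0)) ⟩
    1# * y              ≈⟨ *-identityˡ y ⟩
    y                   ∎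

  x*[x⁻¹*y]≈y : ∀ {x} (x≉0 : x ≉ 0#) y → x * (inv x x≉0 * y) ≈ y
  x*[x⁻¹*y]≈y {x} x≉0 y = begin
    x * (inv x x≉0 * y) ≈⟨ *-assoc _ _ _ ⟨
    x * inv x x≉0 * y   ≈⟨ *-congʳ (x*x⁻¹≈1 x≉0) ⟩
    1# * y              ≈⟨ *-identityˡ y ⟩
    y                   ∎

  x≉0∧xy≈0⇒y≈0 : ∀ {x y} → x ≉ 0# → x * y ≈ 0# → y ≈ 0#
  x≉0∧xy≈0⇒y≈0 {x} {y} x≉0 xy≈0 = begin
    y                   ≈⟨ x⁻¹*[x*y]≈y x≉0 y ⟨
    inv x x≉0 * (x * y) ≈⟨ *-congˡ xy≈0 ⟩
    inv x x≉0 * 0#      ≈⟨ zeroʳ _ ⟩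
    0#                  ∎

  x≉0∧y≉0⇒xy≉0 : ∀ {x y} → x ≉ 0# → y ≉ 0# → x * y ≉ 0#
  x≉0∧y≉0⇒xy≉0 x≉0 y≉0 = y≉0 ∘ x≉0∧xy≈0⇒y≈0 x≉0

  x⁻¹≉0 : ∀ {x} (x≉0 : x ≉ 0#) → inv x x≉0 ≉ 0#
  x⁻¹≉0 {x} x≉0 x⁻¹≈0 = 1≉0 (begin
    1#             ≈⟨ x*x⁻¹≈1 x≉0 ⟨
    x * inv x x≉0  ≈⟨ *-congˡ x⁻¹≈0 ⟩
    x * 0#         ≈⟨ zeroʳ x ⟩
    0#             ∎)

  inverse-of-product : ∀ {x y z z′ x′ y′} → z ≈ x * y → z * z′ ≈ 1# →
                       x * x′ ≈ 1# → y * y′ ≈ 1# → z′ ≈ x′ * y′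
  inverse-of-product {x} {y} {z} {z′} {x′} {y′} z≈xy zz′≈1 xx′≈1 yy′≈1 = begin
    z′                           ≈⟨ *-identityʳ z′ ⟨
    z′ * 1#                      ≈⟨ *-congˡ (*-identityˡ 1#) ⟨
    z′ * (1# * 1#)               ≈⟨ *-congˡ (*-cong xx′≈1 yy′≈1) ⟨
    z′ * ((x * x′) * (y * y′))   ≈⟨ *-congˡ (interchange x x′ y y′) ⟩
    z′ * ((x * y) * (x′ * y′))   ≈⟨ *-congˡ (*-congʳ z≈xy) ⟨
    z′ * (z * (x′ * y′))         ≈⟨ x∙yz≈y∙xz z′ z _ ⟩
    z * (z′ * (x′ * y′))         ≈⟨ *-assoc z z′ _ ⟨
    (z * z′) * (x′ * y′)         ≈⟨ *-congʳ zz′≈1 ⟩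
    1# * (x′ * y′)               ≈⟨ *-identityˡ _ ⟩
    x′ * y′                      ∎

  pow≡^ : ∀ x n → pow x n ≡ x ^ n
  pow≡^ x zero    = ≡.refl
  pow≡^ x (suc n) = ≡.cong (x *_) (pow≡^ x n)

  pow-1# : ∀ n → pow 1# n ≈ 1#
  pow-1# zero    = refl
  pow-1# (suc n) = trans (*-identityˡ _) (pow-1# n)

  pow-congˡ : ∀ n {x y} → x ≈ y → pow x n ≈ pow y n
  pow-congˡ n {x} {y} x≈y = begin
    pow x n ≡⟨ pow≡^ x n ⟩
    x ^ n   ≈⟨ ^-congˡ n x≈y ⟩
    y ^ n   ≡⟨ pow≡^ y n ⟨
    pow y n ∎

  pow-distrib-* : ∀ x y n → pow (x * y) n ≈ pow x n * pow y n
  pow-distrib-* x y n = begin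
    pow (x * y) n     ≡⟨ pow≡^ (x * y) n ⟩
    (x * y) ^ n       ≈⟨ ^-distrib-* x y n ⟩
    x ^ n * y ^ n     ≡⟨ ≡.cong₂ _*_ (pow≡^ x n) (pow≡^ y n) ⟨
    pow x n * pow y n ∎

  module _ (q e : ℕ) where

    InSubfield-1 : InSubfield q e 1#
    InSubfield-1 = pow-1# (q ℕ.^ e)

    InSubfield-* : ∀ {x y} → InSubfield q e x → InSubfield q e y → InSubfield q e (x * y)
    InSubfield-* {x} {y} x∈F y∈F = trans (pow-distrib-* x y (q ℕ.^ e)) (*-cong x∈F y∈F)

    InSubfield-inverse : ∀ {x y} → InSubfield q e x → x * y ≈ 1# → InSubfield q e y
    InSubfield-inverse {x} {y} x∈F xy≈1 = begin
      pow y n                 ≈⟨ *-identityˡ _ ⟨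
      1# * pow y n            ≈⟨ *-congʳ (trans (*-comm y x) xy≈1) ⟨
      y * x * pow y n         ≈⟨ *-assoc y x _ ⟩
      y * (x * pow y n)       ≈⟨ *-congˡ (*-congʳ x∈F) ⟨
      y * (pow x n * pow y n) ≈⟨ *-congˡ (pow-distrib-* x y n) ⟨
      y * pow (x * y) n       ≈⟨ *-congˡ (trans (pow-congˡ n xy≈1) (pow-1# n)) ⟩
      y * 1#                  ≈⟨ *-identityʳ y ⟩
      y                       ∎
      where n = q ℕ.^ e

  foldr-tabulate≡sum : ∀ {a} {A : Set a} {n} (f : A → Carrier) (h : Fin n → A) →
                       foldr (λ i acc → f i + acc) 0# (tabulate h) ≡ +Σ.sum (f ∘ h)
  foldr-tabulate≡sum {n = zero}  f h = ≡.refl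
  foldr-tabulate≡sum {n = suc n} f h = ≡.cong (f (h 0F) +_) (foldr-tabulate≡sum f (h ∘ suc))

  sumFin-concentrated : ∀ {m} (f : Fin m → Carrier) (a : Fin m) → (∀ j → j ≢ a → f j ≈ 0#) →
                        sumFin f ≈ f a
  sumFin-concentrated {suc m} f a off = begin
    sumFin f                        ≡⟨ foldr-tabulate≡sum f id ⟩
    +Σ.sum f                        ≈⟨ +Σ.sum-remove {i = a} f ⟩
    f a + +Σ.sum (f ∘ punchIn a)    ≈⟨ +-congˡ (+Σ.sum-cong-≋ (λ j → off (punchIn a j) (punchInᵢ≢i a j))) ⟩
    f a + +Σ.sum (replicate m 0#)   ≈⟨ +-congˡ (+Σ.sum-replicate-zero m) ⟩
    f a + 0#                        ≈⟨ +-identityʳ (f a) ⟩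
    f a                             ∎

  identity-diagonal : ∀ {m} (i : Fin m) → identity i i ≈ 1#
  identity-diagonal i with i Fin.≟ i
  ... | yes _   = refl
  ... | no i≢i = contradiction ≡.refl i≢i

  identity-off-diagonal : ∀ {m} {i j : Fin m} → i ≢ j → identity i j ≈ 0#
  identity-off-diagonal {i = i} {j} i≢j with i Fin.≟ j
  ... | yes i≡j = contradiction i≡j i≢j
  ... | no _    = refl

  ∼-reflexive : ∀ {m} {u v : Vec m} → (∀ i → u i ≈ v i) → u ∼ v
  ∼-reflexive u≈v = 1# , 1≉0 , λ i → trans (u≈v i) (sym (*-identityˡ _))

  ∼-sym : ∀ {m} {u v : Vec m} → u ∼ v → v ∼ u
  ∼-sym (s , s≉0 , u≈sv) = inv s s≉0 , x⁻¹≉0 s≉0 ,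
    λ i → trans (sym (x⁻¹*[x*y]≈y s≉0 _)) (*-congˡ (sym (u≈sv i)))

  ∼-trans : ∀ {m} {u v w : Vec m} → u ∼ v → v ∼ w → u ∼ w
  ∼-trans (s , s≉0 , u≈sv) (t , t≉0 , v≈tw) = s * t , x≉0∧y≉0⇒xy≉0 s≉0 t≉0 ,
    λ i → trans (u≈sv i) (trans (*-congˡ (v≈tw i)) (sym (*-assoc s t _)))

  ∼-weight : ∀ {m} {u v : Vec m} → u ∼ v → weight u ≡ weight v
  ∼-weight {u = u} {v} (s , s≉0 , u≈sv) =
    ≡.cong length (filter-≐ (λ i → ¬? (u i ≟ 0#)) (λ i → ¬? (v i ≟ 0#)) (u≉0⇒v≉0 , v≉0⇒u≉0) (allFin _))
    where
    u≉0⇒v≉0 : ∀ {i} → u i ≉ 0# → v i ≉ 0#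
    u≉0⇒v≉0 {i} u≉0 v≈0 = u≉0 (trans (u≈sv i) (trans (*-congˡ v≈0) (zeroʳ s)))
    v≉0⇒u≉0 : ∀ {i} → v i ≉ 0# → u i ≉ 0#
    v≉0⇒u≉0 {i} v≉0 u≈0 = v≉0 (x≉0∧xy≈0⇒y≈0 s≉0 (trans (sym (u≈sv i)) u≈0))

  support : ∀ {m} → Vec m → Fin m → Bool
  support v i = does (¬? (v i ≟ 0#))

  weight≡count-support : ∀ {m} (v : Vec m) → weight v ≡ count (support v)
  weight≡count-support v = length-filter-tabulate (λ i → ¬? (v i ≟ 0#)) id

  weight≡⇒aligned-zeros : ∀ {m} {u v : Vec m} → weight u ≡ weight v →
                          ∃[ σ ] (∀ i → u (σ ⟨$⟩ʳ i) ≈ 0# ⇔ v i ≈ 0#)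
  weight≡⇒aligned-zeros {u = u} {v} u≡v
    with σ , aligned ← count≡⇒rearrangeable (support u) (support v)
                         (≡.trans (≡.sym (weight≡count-support u)) (≡.trans u≡v (weight≡count-support v)))
    = σ , λ i → does≡⇒⇔ (u (σ ⟨$⟩ʳ i) ≟ 0#) (v i ≟ 0#) (not-injective (aligned i))

  record Monomial (m : ℕ) : Set (c ⊔ ℓ) where
    field
      σ   : Permutation′ m
      d   : Fin m → Carrier
      d≉0 : ∀ i → d i ≉ 0#

    matrix : Matrix m
    matrix i j = d i * identity (σ ⟨$⟩ʳ i) j

  open Monomial using (σ; d; d≉0; matrix)

  _⁻¹ : ∀ {m} → Monomial m → Monomial m
  μ ⁻¹ = record
    { σ   = Perm.flip (σ μ)
    ; d   = λ l → inv (d μ (σ μ ⟨$⟩ˡ l)) (d≉0 μ _)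
    ; d≉0 = λ l → x⁻¹≉0 (d≉0 μ _)
    }

  apply-matrix : ∀ {m} (μ : Monomial m) (x : Vec m) i → apply (matrix μ) x i ≈ d μ i * x (σ μ ⟨$⟩ʳ i)
  apply-matrix μ x i = begin
    apply (matrix μ) x i                ≈⟨ sumFin-concentrated _ σi off ⟩
    d μ i * identity σi σi * x σi       ≈⟨ *-congʳ (*-congˡ (identity-diagonal σi)) ⟩
    d μ i * 1# * x σi                   ≈⟨ *-congʳ (*-identityʳ (d μ i)) ⟩
    d μ i * x σi                        ∎
    where
    σi = σ μ ⟨$⟩ʳ i
    off : ∀ j → j ≢ σi → d μ i * identity σi j * x j ≈ 0#
    off j j≢σi = trans (*-congʳ (trans (*-congˡ (identity-off-diagonal (j≢σi ∘ ≡.sym))) (zeroʳ (d μ i))))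
                       (zeroˡ (x j))

  d*[d⁻¹*x]≈x : ∀ {m} (μ : Monomial m) (x : Vec m) {i i′} → i′ ≡ i →
                d μ i * (inv (d μ i′) (d≉0 μ i′) * x i′) ≈ x i
  d*[d⁻¹*x]≈x μ x ≡.refl = x*[x⁻¹*y]≈y (d≉0 μ _) _

  module _ {m} (μ : Monomial m) where

    apply-matrix-⁻¹ : ∀ (x : Vec m) i → apply (matrix μ) (apply (matrix (μ ⁻¹)) x) i ≈ x i
    apply-matrix-⁻¹ x i = begin
      apply (matrix μ) (apply (matrix (μ ⁻¹)) x) i  ≈⟨ apply-matrix μ _ i ⟩
      d μ i * apply (matrix (μ ⁻¹)) x σi            ≈⟨ *-congˡ (apply-matrix (μ ⁻¹) x σi) ⟩
      d μ i * (d (μ ⁻¹) σi * x (σ μ ⟨$⟩ˡ σi))       ≈⟨ d*[d⁻¹*x]≈x μ x (Perm.inverseˡ (σ μ)) ⟩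
      x i                                           ∎
      where σi = σ μ ⟨$⟩ʳ i

    matrix-invertible : Invertible (matrix μ)
    matrix-invertible = matrix (μ ⁻¹) , inverseʳ , inverseˡ
      where
      inverseʳ : ∀ i j → mul (matrix μ) (matrix (μ ⁻¹)) i j ≈ identity i j
      inverseʳ i j = trans (apply-matrix μ _ i)
        (d*[d⁻¹*x]≈x μ (λ l → identity l j) (Perm.inverseˡ (σ μ)))
      inverseˡ : ∀ i j → mul (matrix (μ ⁻¹)) (matrix μ) i j ≈ identity i j
      inverseˡ i j = trans (apply-matrix (μ ⁻¹) _ i)
        (trans (x⁻¹*[x*y]≈y (d≉0 μ _) _) (reflexive (≡.cong (λ l → identity l j) (Perm.inverseʳ (σ μ)))))

    apply-matrix-NonZero : ∀ {v : Vec m} → NonZero v → NonZero (apply (matrix μ) v)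
    apply-matrix-NonZero {v} v≢0 Mv≈0 = v≢0 λ j →
      ≡.subst (λ l → v l ≈ 0#) (Perm.inverseʳ (σ μ))
        (x≉0∧xy≈0⇒y≈0 (d≉0 μ _) (trans (sym (apply-matrix μ v (σ μ ⟨$⟩ˡ j))) (Mv≈0 (σ μ ⟨$⟩ˡ j))))

    apply-matrix-resp-∼ : ∀ {u v : Vec m} → u ∼ v → apply (matrix μ) u ∼ apply (matrix μ) v
    apply-matrix-resp-∼ {u} {v} (s , s≉0 , u≈sv) = s , s≉0 , λ i → begin
      apply (matrix μ) u i           ≈⟨ apply-matrix μ u i ⟩
      d μ i * u (σ μ ⟨$⟩ʳ i)         ≈⟨ *-congˡ (u≈sv _) ⟩
      d μ i * (s * v (σ μ ⟨$⟩ʳ i))   ≈⟨ x∙yz≈y∙xz (d μ i) s _ ⟩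
      s * (d μ i * v (σ μ ⟨$⟩ʳ i))   ≈⟨ *-congˡ (apply-matrix μ v i) ⟨
      s * apply (matrix μ) v i       ∎

  module _ (q k : ℕ) where

    InR-resp-≈ : ∀ {z z′} → z ≈ z′ → InR q k z → InR q k z′
    InR-resp-≈ z≈z′ (x , y , x∈F , y∈F , z≈xy) = x , y , x∈F , y∈F , trans (sym z≈z′) z≈xy

    InR-1 : InR q k 1#
    InR-1 = 1# , 1# , InSubfield-1 q (k ∸ 1) , InSubfield-1 q k , sym (*-identityˡ 1#)

    InR-* : ∀ {z z′} → InR q k z → InR q k z′ → InR q k (z * z′)
    InR-* (x , y , x∈F , y∈F , z≈xy) (x′ , y′ , x′∈F , y′∈F , z′≈x′y′) =
      x * x′ , y * y′ , InSubfield-* q (k ∸ 1) x∈F x′∈F , InSubfield-* q k y∈F y′∈F ,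
      trans (*-cong z≈xy z′≈x′y′) (interchange x y x′ y′)

    -- the inverses of x and y are read off from z⁻¹ = z′ as y z′ and x z′
    InR-inverse : ∀ {z z′} → InR q k z → z * z′ ≈ 1# → InR q k z′
    InR-inverse {z} {z′} (x , y , x∈F , y∈F , z≈xy) zz′≈1 =
      y * z′ , x * z′ , InSubfield-inverse q (k ∸ 1) x∈F x[yz′]≈1 , InSubfield-inverse q k y∈F y[xz′]≈1 ,
      inverse-of-product z≈xy zz′≈1 x[yz′]≈1 y[xz′]≈1
      where
      x[yz′]≈1 : x * (y * z′) ≈ 1#
      x[yz′]≈1 = trans (sym (*-assoc x y z′)) (trans (*-congʳ (sym z≈xy)) zz′≈1)
      y[xz′]≈1 : y * (x * z′) ≈ 1#
      y[xz′]≈1 = trans (x∙yz≈y∙xz y x z′) x[yz′]≈1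

    ScalesInR : ∀ {m} → Monomial m → Set (c ⊔ ℓ)
    ScalesInR μ = ∀ i → InR q k (d μ i)

    ⁻¹-ScalesInR : ∀ {m} (μ : Monomial m) → ScalesInR μ → ScalesInR (μ ⁻¹)
    ⁻¹-ScalesInR μ d∈R l = InR-inverse (d∈R _) (x*x⁻¹≈1 (d≉0 μ _))

    matrix-preserves-B : ∀ (μ : Monomial (k ∸ 1)) → ScalesInR μ →
                         ∀ v → InB q k v → InB q k (apply (matrix μ) v)
    matrix-preserves-B μ d∈R v (v≢0 , w , w∼v , w∈R) =
      apply-matrix-NonZero μ v≢0 , apply (matrix μ) w , apply-matrix-resp-∼ μ w∼v ,
      λ i → InR-resp-≈ (sym (apply-matrix μ w i)) (InR-* (d∈R i) (w∈R _))

    matrix-stabilises-B : ∀ (μ : Monomial (k ∸ 1)) → ScalesInR μ → StabilisesB q k (matrix μ)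
    matrix-stabilises-B μ d∈R = matrix-preserves-B μ d∈R , λ v v∈B →
      apply (matrix (μ ⁻¹)) v , matrix-preserves-B (μ ⁻¹) (⁻¹-ScalesInR μ d∈R) v v∈B ,
      ∼-reflexive (apply-matrix-⁻¹ μ v)

    aligned-zeros⇒R-monomial : ∀ {m} {w w′ : Vec m} → ∃[ σ ] (∀ i → w (σ ⟨$⟩ʳ i) ≈ 0# ⇔ w′ i ≈ 0#) →
                               (∀ i → InR q k (w i)) → (∀ i → InR q k (w′ i)) →
                               ∃[ μ ] (ScalesInR μ × (∀ i → apply (matrix μ) w i ≈ w′ i))
    aligned-zeros⇒R-monomial {m} {w} {w′} (τ , zeros) w∈R w′∈R =
      μ , proj₁ ∘ proj₂ ∘ proj₂ ∘ ratio ,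
      λ i → trans (apply-matrix μ w i) (proj₂ (proj₂ (proj₂ (ratio i))))
      where
      ratio : ∀ i → Σ[ r ∈ Carrier ] (r ≉ 0# × InR q k r × r * w (τ ⟨$⟩ʳ i) ≈ w′ i)
      ratio i with w′ i ≟ 0#
      ... | yes w′≈0 = 1# , 1≉0 , InR-1 ,
                       trans (*-identityˡ _) (trans (Equivalence.from (zeros i) w′≈0) (sym w′≈0))
      ... | no w′≉0 = inv (w (τ ⟨$⟩ʳ i)) w≉0 * w′ i , x≉0∧y≉0⇒xy≉0 (x⁻¹≉0 w≉0) w′≉0 ,
                      InR-* (InR-inverse (w∈R _) (x*x⁻¹≈1 w≉0)) (w′∈R i) ,
                      trans (*-comm _ _) (x*[x⁻¹*y]≈y w≉0 (w′ i))
        where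
        w≉0 : w (τ ⟨$⟩ʳ i) ≉ 0#
        w≉0 = w′≉0 ∘ Equivalence.to (zeros i)
      μ : Monomial m
      μ = record { σ = τ ; d = proj₁ ∘ ratio ; d≉0 = proj₁ ∘ proj₂ ∘ ratio }

    equal-weight⇒∃stabilising-matrix :
      ∀ {u v : Vec (k ∸ 1)} → InB q k u → InB q k v → weight u ≡ weight v →
      ∃[ M ] (Invertible M × StabilisesB q k M × apply M u ∼ v)
    equal-weight⇒∃stabilising-matrix (_ , wᵤ , wᵤ∼u , wᵤ∈R) (_ , wᵥ , wᵥ∼v , wᵥ∈R) u≡v
      with μ , d∈R , μwᵤ≈wᵥ ← aligned-zeros⇒R-monomial
             (weight≡⇒aligned-zeros (≡.trans (∼-weight wᵤ∼u) (≡.trans u≡v (≡.sym (∼-weight wᵥ∼v)))))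
             wᵤ∈R wᵥ∈R
      = matrix μ , matrix-invertible μ , matrix-stabilises-B μ d∈R ,
        ∼-trans (apply-matrix-resp-∼ μ (∼-sym wᵤ∼u)) (∼-trans (∼-reflexive μwᵤ≈wᵥ) wᵥ∼v)

open import Data.Nat using (_*_; _^_)

lemma2p5 : ∀ {c ℓ : Level} (q k : ℕ) → IsPrimePower q → k ≥ 3 →
    (F : FiniteField c ℓ (q ^ (k * (k ∸ 1)))) →
    let open FF F in
    ∀ (u v : Vec (k ∸ 1)) → InB q k u → InB q k v → weight u ≡ weight v →
    ∃[ M ] (Invertible M × StabilisesB q k M × apply M u ∼ v)
lemma2p5 q k _ _ F u v = MonomialAction.equal-weight⇒∃stabilising-matrix F q k
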